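{- Let $G=(V,A)$ be a flow graph with start vertex $s$, let $T$ be a rooted tree with the parent property, and let $S$ be the (nonempty) vertex set of a strongly connected subgraph of $G$. Then there is a nonempty set $X\subseteq S$ such that either $X$ is a single vertex or all vertices of $X$ have the same parent in $T$, and every vertex of $S$ is a descendant in $T$ of some vertex of $X$ (that is, $S$ consists of a set of siblings in $T$ and possibly some of their descendants).
   Context: A flow graph is a finite directed graph $G=(V,A)$ with start vertex $s$ such that every vertex is reachable from $s$; there are no arcs entering $s$. For a rooted tree $T$ with vertex set contained in $V$, $t(v)$ denotes the parent of $v$; ancestors and descendants include the vertex itself. $T$ has the parent property if for every arc $(v,w)\in A$, $t(w)$ is an ancestor of $v$ in $T$. A subgraph is strongly connected if there is a path between any two of its vertices using only vertices of the subgraph. -}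

module Defs where

open import Data.Nat using (ℕ)
open import Data.Unit using (⊤)
open import Data.Fin using (Fin)
open import Data.Fin.Subset using (Subset; _∈_; _⊆_)
open import Data.List using (List)
import Data.List.Membership.Propositional as LM
open import Data.Product using (_×_; _,_; Σ; ∃; ∃-syntax)
open import Data.Sum using (_⊎_)
open import Data.Maybe using (Maybe; just; nothing)
open import Relation.Binary.PropositionalEquality using (_≡_)
open import Relation.Nullary using (¬_)

Graph : ℕ → Set
Graph n = List (Fin n × Fin n)

module _ {n : ℕ} (G : Graph n) where

  Arc : Fin n → Fin n → Set
  Arc v w = (v , w) LM.∈ G

  data PathIn (P : Fin n → Set) : Fin n → Fin n → Set where
    stop : ∀ {x} → P x → PathIn P x x
    step : ∀ {x z y} → P x → Arc x z → PathIn P z y → PathIn P x y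

  Path : Fin n → Fin n → Set
  Path = PathIn (λ _ → ⊤)

  record IsFlowGraph (s : Fin n) : Set where
    field
      reachable : ∀ v → Path s v
      no-entry  : ∀ v → ¬ Arc v s

  StronglyConnected : Subset n → Set
  StronglyConnected S = ∀ x y → x ∈ S → y ∈ S → PathIn (λ v → v ∈ S) x y

-- A rooted tree on the vertices: parent function (nothing = no parent).
module _ {n : ℕ} (t : Fin n → Maybe (Fin n)) where

  data Ancestor (u : Fin n) : Fin n → Set where
    self : Ancestor u u
    up   : ∀ {v w} → t v ≡ just w → Ancestor u w → Ancestor u v

  -- t is a rooted tree with root r: r has no parent and r is an
  -- ancestor of every vertex (so parent chains are finite, no cycles).
  record IsRootedTree (r : Fin n) : Set where
    field
      root-no-parent : t r ≡ nothing
      root-ancestor  : ∀ v → Ancestor r v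

module _ {n : ℕ} (G : Graph n) (t : Fin n → Maybe (Fin n)) where

  ParentProperty : Set
  ParentProperty = ∀ v w → Arc G v w → ∃[ p ] (t w ≡ just p × Ancestor t p v)

module Submission where

-- Measure each vertex by its depth in the rooted tree T and
-- pick a vertex x of S of minimum depth.
--   * If x has no parent it is the root; then X = {x} covers all of S.
--   * If t(x) = p, let X be the set of vertices of S whose parent is p.
--     The set of vertices having an ancestor in X is closed under arcs
--     (u,w) of G with w ∈ S: the parent q of w is an ancestor of u by the
--     parent property, and the ancestors of u form a chain, so either an
--     element c ∈ X is an ancestor of q (hence of w), or q is c itself,
--     or q is an ancestor of p; in the last case minimality of x forces
--     depth q ≥ depth p, so q = p and w ∈ X.  Strong connectivity gives
--     a path inside S from x to any v ∈ S, along which coverage travels.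

open import Defs
open import Data.Nat using (ℕ; suc; _≤_; _<_; _<?_; s≤s⁻¹)
open import Data.Nat.Properties using (≤-refl; ≤-trans; m≤n⇒m≤1+n; ≮⇒≥; 1+n≰n)
open import Data.Nat.Induction using (<-rec)
open import Data.Fin using (Fin; _≟_)
open import Data.Fin.Subset using (Subset; _∈_; _⊆_; ⁅_⁆)
open import Data.Fin.Subset.Properties using (_∈?_; x∈⁅x⁆; x∈⁅y⁆⇒x≡y)
open import Data.Fin.Properties using (any?)
open import Data.Maybe using (Maybe; just; nothing)
open import Data.Maybe.Properties using (just-injective) renaming (≡-dec to maybe-≡-dec)
open import Data.Vec using (tabulate)
open import Data.Vec.Properties using ([]=⇒lookup; lookup⇒[]=; lookup∘tabulate)
open import Data.Product using (_×_; _,_; proj₁; proj₂; ∃; ∃-syntax)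
open import Data.Sum using (_⊎_; inj₁; inj₂)
open import Level using (Level)
open import Relation.Nullary using (yes; no; does; contradiction)
open import Relation.Nullary.Decidable using (_×-dec_; dec-true)
open import Relation.Unary using (Pred; Decidable)
open import Relation.Binary.PropositionalEquality using (_≡_; refl; sym; trans; cong; subst; subst₂)

private
  variable
    ℓ : Level
    n : ℕ

minimal-element : {P : Pred (Fin n) ℓ} → Decidable P → (f : Fin n → ℕ) →
                  ∃ P → ∃[ x ] (P x × (∀ y → P y → f x ≤ f y))
minimal-element {n = n} {P = P} P? f (x , px) = <-rec Search search (f x) x refl px
  where
  Search : ℕ → Set _
  Search k = ∀ x → f x ≡ k → P x → ∃[ x ] (P x × (∀ y → P y → f x ≤ f y))

  search : ∀ k → (∀ {j} → j < k → Search j) → Search k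
  search _ smaller x refl px with any? (λ y → P? y ×-dec (f y <? f x))
  ... | yes (y , py , fy<fx) = smaller fy<fx y refl py
  ... | no none = x , px , λ y py → ≮⇒≥ (λ fy<fx → none (y , py , fy<fx))

select : {P : Pred (Fin n) ℓ} → Decidable P → Subset n
select P? = tabulate (λ y → does (P? y))

select-sound : {P : Pred (Fin n) ℓ} (P? : Decidable P) {y : Fin n} → y ∈ select P? → P y
select-sound P? {y} y∈ with P? y | trans (sym (lookup∘tabulate _ y)) ([]=⇒lookup y∈)
... | yes py | _ = py
... | no _   | ()

select-complete : {P : Pred (Fin n) ℓ} (P? : Decidable P) {y : Fin n} → P y → y ∈ select P?
select-complete P? {y} py =
  lookup⇒[]= y (select P?) (trans (lookup∘tabulate _ y) (dec-true (P? y) py))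

module Ancestors (t : Fin n → Maybe (Fin n)) where

  -- Two ancestors of the same vertex lie on its parent chain, so one is an
  -- ancestor of the other.
  ancestors-comparable : ∀ {a b u} → Ancestor t a u → Ancestor t b u →
                         Ancestor t a b ⊎ Ancestor t b a
  ancestors-comparable self     b≼u        = inj₂ b≼u
  ancestors-comparable (up e a≼w) self     = inj₁ (up e a≼w)
  ancestors-comparable (up e a≼w) (up e′ b≼w′) with just-injective (trans (sym e) e′)
  ... | refl = ancestors-comparable a≼w b≼w′

  height : ∀ {a v} → Ancestor t a v → ℕ
  height self       = 0
  height (up _ a≼w) = suc (height a≼w)

module RootedTree {t : Fin n → Maybe (Fin n)} {r : Fin n} (tree : IsRootedTree t r) where
  open IsRootedTree tree
  open Ancestors t

  root-has-no-parent : ∀ {w} → t r ≡ just w → ∀ {A : Set} → A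
  root-has-no-parent e with trans (sym root-no-parent) e
  ... | ()

  -- Parent chains from the root are unique, so their length is well defined.
  height-unique : ∀ {v} (A B : Ancestor t r v) → height A ≡ height B
  height-unique self       self       = refl
  height-unique self       (up e _)   = root-has-no-parent e
  height-unique (up e _)   self       = root-has-no-parent e
  height-unique (up e A) (up e′ B) with just-injective (trans (sym e) e′)
  ... | refl = cong suc (height-unique A B)

  depth : Fin n → ℕ
  depth v = height (root-ancestor v)

  depth-child : ∀ {v w} → t v ≡ just w → depth v ≡ suc (depth w)
  depth-child {v} = chain-height (root-ancestor v)
    where
    chain-height : ∀ {v w} (A : Ancestor t r v) → t v ≡ just w → height A ≡ suc (depth w)
    chain-height self       e  = root-has-no-parent e
    chain-height (up e′ A) e with just-injective (trans (sym e′) e)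
    ... | refl = cong suc (height-unique A (root-ancestor _))

  ancestor-depth : ∀ {a b} → Ancestor t a b → depth a ≤ depth b
  ancestor-depth self       = ≤-refl
  ancestor-depth {a} (up e a≼w) =
    subst (depth a ≤_) (sym (depth-child e)) (m≤n⇒m≤1+n (ancestor-depth a≼w))

  ancestor-not-shallower : ∀ {a b} → Ancestor t a b → depth b ≤ depth a → a ≡ b
  ancestor-not-shallower self        _ = refl
  ancestor-not-shallower (up e a≼w) b≤a =
    contradiction (≤-trans (subst (_≤ _) (depth-child e) b≤a) (ancestor-depth a≼w)) 1+n≰n

  -- A vertex without parent is the root, hence an ancestor of every vertex.
  parentless-ancestor : ∀ {x} → t x ≡ nothing → ∀ v → Ancestor t x v
  parentless-ancestor {x} tx v with root-ancestor x
  ... | self      = root-ancestor v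
  ... | up e _    with trans (sym tx) e
  ... | ()

module Paths (G : Graph n) where

  path-head : ∀ {P a b} → PathIn G P a b → P a
  path-head (stop pa)     = pa
  path-head (step pa _ _) = pa

  transport-along : ∀ {P Q : Fin n → Set} →
                    (∀ {u w} → Q u → Arc G u w → P w → Q w) →
                    ∀ {a b} → PathIn G P a b → Q a → Q b
  transport-along step-Q (stop _)        qa = qa
  transport-along step-Q (step _ arc π) qa =
    transport-along step-Q π (step-Q qa arc (path-head π))

IsSiblingCover : (t : Fin n → Maybe (Fin n)) (S X : Subset n) → Set
IsSiblingCover t S X =
  X ⊆ S × (∃[ x ] x ∈ X)
  × ((∃[ x ] (∀ y → y ∈ X → y ≡ x)) ⊎ (∃[ p ] (∀ x → x ∈ X → t x ≡ just p)))
  × (∀ v → v ∈ S → ∃[ x ] (x ∈ X × Ancestor t x v))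

root-cover : (t : Fin n → Maybe (Fin n)) (r : Fin n) → IsRootedTree t r →
             (S : Subset n) (x : Fin n) → x ∈ S → t x ≡ nothing →
             IsSiblingCover t S ⁅ x ⁆
root-cover t r tree S x x∈S tx =
    (λ {y} y∈X → subst (_∈ S) (sym (x∈⁅y⁆⇒x≡y x y∈X)) x∈S)
  , (x , x∈⁅x⁆ x)
  , inj₁ (x , λ y → x∈⁅y⁆⇒x≡y x)
  , λ v _ → x , x∈⁅x⁆ x , RootedTree.parentless-ancestor tree tx v

module SiblingCover (G : Graph n) (t : Fin n → Maybe (Fin n)) (r : Fin n)
                    (tree : IsRootedTree t r) (pp : ParentProperty G t)
                    (S : Subset n) (sc : StronglyConnected G S)
                    (x : Fin n) (x∈S : x ∈ S)
                    (x-minimal : ∀ y → y ∈ S → RootedTree.depth tree x ≤ RootedTree.depth tree y)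
                    (p : Fin n) (tx : t x ≡ just p) where
  open Ancestors t
  open RootedTree tree
  open Paths G

  IsSibling : Fin n → Set
  IsSibling y = y ∈ S × t y ≡ just p

  sibling? : Decidable IsSibling
  sibling? y = (y ∈? S) ×-dec maybe-≡-dec _≟_ (t y) (just p)

  X : Subset n
  X = select sibling?

  sibling-sound : ∀ {y} → y ∈ X → IsSibling y
  sibling-sound = select-sound sibling?

  sibling-complete : ∀ {y} → IsSibling y → y ∈ X
  sibling-complete = select-complete sibling?

  Covered : Fin n → Set
  Covered u = ∃[ c ] (c ∈ X × Ancestor t c u)

  parents-not-shallower : ∀ {w q} → w ∈ S → t w ≡ just q → depth p ≤ depth q
  parents-not-shallower {w} w∈S tw =
    s≤s⁻¹ (subst₂ _≤_ (depth-child tx) (depth-child tw) (x-minimal w w∈S))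

  -- The parent q of w is an ancestor
  -- of u, hence comparable with c: either c ≼ q, or q = c, or q is an
  -- ancestor of p = t(c), in which case q = p by depth and w is a sibling.
  cover-step : ∀ {u w} → Covered u → Arc G u w → w ∈ S → Covered w
  cover-step {u} {w} (c , c∈X , c≼u) arc w∈S with pp u w arc
  ... | q , tw , q≼u with ancestors-comparable c≼u q≼u
  ... | inj₁ c≼q         = c , c∈X , up tw c≼q
  ... | inj₂ self        = c , c∈X , up tw self
  ... | inj₂ (up tc q≼p′) with just-injective (trans (sym tc) (proj₂ (sibling-sound c∈X)))
  ... | refl with ancestor-not-shallower q≼p′ (parents-not-shallower w∈S tw)
  ... | refl = w , sibling-complete (w∈S , tw) , self

  covers : ∀ v → v ∈ S → Covered v
  covers v v∈S =
    transport-along cover-step (sc x v x∈S v∈S) (x , sibling-complete (x∈S , tx) , self)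

  sibling-cover : IsSiblingCover t S X
  sibling-cover =
      (λ y∈X → proj₁ (sibling-sound y∈X))
    , (x , sibling-complete (x∈S , tx))
    , inj₂ (p , λ _ y∈X → proj₂ (sibling-sound y∈X))
    , covers

lemma10 : (n : ℕ) (G : Graph n) (s : Fin n) → IsFlowGraph G s →
          (t : Fin n → Maybe (Fin n)) (r : Fin n) → IsRootedTree t r →
          ParentProperty G t →
          (S : Subset n) → (∃[ x ] x ∈ S) → StronglyConnected G S →
          ∃[ X ] (X ⊆ S × (∃[ x ] x ∈ X)
                  × ((∃[ x ] (∀ y → y ∈ X → y ≡ x)) ⊎ (∃[ p ] (∀ x → x ∈ X → t x ≡ just p)))
                  × (∀ v → v ∈ S → ∃[ x ] (x ∈ X × Ancestor t x v)))
lemma10 n G s _ t r tree pp S S-nonempty sc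
  with minimal-element (_∈? S) (RootedTree.depth tree) S-nonempty
... | x , x∈S , x-minimal with t x in tx
... | nothing = ⁅ x ⁆ , root-cover t r tree S x x∈S tx
... | just p  = X , sibling-cover
  where open SiblingCover G t r tree pp S sc x x∈S x-minimal p tx
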